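{- Let $\mathcal{C}$ be a nice clustering for a facility location instance $(F,D)$ and let $\alpha_j=2^{\ell(j)}$ for every client $j\in D$. Then for every facility $i\in F$, $\sum_{j\in D}\max\left(0,\frac{\alpha_j}{2^{10}}-d_{ij}\right)\le f_i$.
   Context: Facility location: finite facility set $F$, finite client set $D$, in a common metric space; $d$ denotes the metric (so $d_{ij}>0$ is the distance between facility $i$ and client $j$, and the triangle inequality holds among all facilities and clients), $f_i\ge0$ the opening cost of facility $i$. Clusters: a cluster is a pair $C=(i,A)$ with $i\in F$, $A\subseteq D$, designated critical or satellite; satellite clusters have exactly one client. $cost(C)=\sum_{j\in A}d_{ij}$ if satellite, $f_i+\sum_{j\in A}d_{ij}$ if critical; $cost_{avg}(C)=cost(C)/|A|$. A clustering is a collection $\mathcal{C}$ of clusters in which every client of $D$ lies in exactly one cluster and, for each facility $i$ with $\mathcal{C}(i)$ (clusters of $\mathcal{C}$ with facility $i$) nonempty, exactly one cluster of $\mathcal{C}(i)$ is critical. Each $C\in\mathcal{C}$ has a level $\ell(C)\in\mathbb{Z}$; $\ell(j)=\ell(C)$ for clients $j$ of $C$. $\kappa^*_{ij}$ is the unique integer with $2^{\kappa^*_{ij}-4}\le d_{ij}<2^{\kappa^*_{ij}-3}$. A cluster $C=(i,A)$ (not necessarily in $\mathcal{C}$) is blocking at level $k$ w.r.t. $\mathcal{C}$ if (a) $cost_{avg}(C)<2^{k-3}$; (b) $\ell(j)>k\ge\kappa^*_{ij}$ for all $j\in A$; (c) if $C$ is satellite, some critical $C^*\in\mathcal{C}(i)$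 has $\ell(C^*)\le k$; if $C$ is critical, $k\le\ell(C')$ for all $C'\in\mathcal{C}(i)$. $\mathcal{C}$ is nice if (I1) $cost_{avg}(C)<2^{\ell(C)}$ for all $C\in\mathcal{C}$; (I2) for each $i$ with $\mathcal{C}(i)\ne\emptyset$ the critical cluster $C^*\in\mathcal{C}(i)$ has $\ell(C^*)\le\ell(C)$ for all $C\in\mathcal{C}(i)$; (I3) $\ell(j)\ge\kappa^*_{ij}$ for every $C=(i,A)\in\mathcal{C}$, $j\in A$; (I4) no cluster is blocking at any level w.r.t. $\mathcal{C}$.
   Formalization: The metric $d$ and the opening costs $f_i$ take rational values. -}

module Defs where

open import Data.Nat as ℕ using (ℕ; zero; suc)
open import Data.Fin using (Fin; zero; suc)
open import Data.Fin.Properties using (_≟_)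
open import Data.Bool using (Bool; true; false; if_then_else_)
open import Data.Integer as ℤ using (ℤ; +_; -[1+_])
open import Data.Rational as ℚ using (ℚ; 0ℚ; 1ℚ; ½; _+_; _*_; _-_; _<_; _≤_; _/_; _⊔_)
open import Data.Sum using (_⊎_; inj₁; inj₂)
open import Data.Product using (Σ; ∃; _×_; _,_)
open import Relation.Binary.PropositionalEquality using (_≡_)
open import Relation.Nullary using (¬_)
open import Relation.Nullary.Decidable using (⌊_⌋)

two^ : ℕ → ℚ
two^ zero    = 1ℚ
two^ (suc n) = (1ℚ + 1ℚ) * two^ n

half^ : ℕ → ℚ
half^ zero    = 1ℚ
half^ (suc n) = ½ * half^ n

pow2 : ℤ → ℚ
pow2 (+ n)    = two^ n
pow2 -[1+ n ] = half^ (suc n)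

sumFin : ∀ {n} → (Fin n → ℚ) → ℚ
sumFin {zero}  g = 0ℚ
sumFin {suc n} g = g zero + sumFin (λ j → g (suc j))

Subset : ℕ → Set
Subset n = Fin n → Bool

count : ∀ {n} → Subset n → ℕ
count {zero}  A = zero
count {suc n} A = (if A zero then 1 else 0) ℕ.+ count (λ j → A (suc j))

sumOn : ∀ {n} → Subset n → (Fin n → ℚ) → ℚ
sumOn A g = sumFin (λ j → if A j then g j else 0ℚ)

-- Facility location instance: facilities Fin m, clients Fin n, living in a
-- common metric space on the points Fin m ⊎ Fin n.

record IsMetric {P : Set} (dist : P → P → ℚ) : Set where
  field
    dist-self  : ∀ x → dist x x ≡ 0ℚ
    dist-zero  : ∀ x y → dist x y ≡ 0ℚ → x ≡ y
    dist-nonneg : ∀ x y → 0ℚ ≤ dist x y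
    dist-sym   : ∀ x y → dist x y ≡ dist y x
    dist-tri   : ∀ x y z → dist x z ≤ dist x y + dist y z

record Instance (m n : ℕ) : Set where
  field
    dist     : Fin m ⊎ Fin n → Fin m ⊎ Fin n → ℚ
    isMetric : IsMetric dist
    f        : Fin m → ℚ
    f-nonneg : ∀ i → 0ℚ ≤ f i

  d : Fin m → Fin n → ℚ
  d i j = dist (inj₁ i) (inj₂ j)

  field
    d-pos : ∀ i j → 0ℚ < d i j

data Kind : Set where
  critical satellite : Kind

cost : ∀ {m n} → Instance m n → Kind → Fin m → Subset n → ℚ
cost I critical  i A = Instance.f I i + sumOn A (Instance.d I i)
cost I satellite i A = sumOn A (Instance.d I i)

-- cost_avg(C) = cost(C) / |A|   (clusters have |A| ≥ 1; the
-- expression suc (pred |A|) equals |A| in that case)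
costAvg : ∀ {m n} → Instance m n → Kind → Fin m → Subset n → ℚ
costAvg I k i A = cost I k i A * (+ 1 / suc (ℕ.pred (count A)))

IsCluster : ∀ {n} → Kind → Subset n → Set
IsCluster k A = (∃ λ j → A j ≡ true) × (k ≡ satellite → count A ≡ 1)

IsKappa : ℚ → ℤ → Set
IsKappa x κ = pow2 (κ ℤ.- + 4) ≤ x × x < pow2 (κ ℤ.- + 3)

-- Clusters are indexed by Fin K; each client j lies in
-- exactly the cluster clu j (so every client lies in exactly one
-- cluster); cluster c is (fac c, {j | clu j ≡ c}) with kind and level.

record Clustering (m n : ℕ) : Set where
  field
    K     : ℕ
    fac   : Fin K → Fin m
    kind  : Fin K → Kind
    level : Fin K → ℤ
    clu   : Fin n → Fin K

  members : Fin K → Subset n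
  members c j = ⌊ clu j ≟ c ⌋

  ℓ : Fin n → ℤ
  ℓ j = level (clu j)

  field
    wf       : ∀ c → IsCluster (kind c) (members c)
    oneCrit  : ∀ i → (∃ λ c → fac c ≡ i) →
               ∃ λ c → fac c ≡ i × kind c ≡ critical ×
                 (∀ c' → fac c' ≡ i → kind c' ≡ critical → c' ≡ c)

module _ {m n : ℕ} (I : Instance m n) (κ : Fin m → Fin n → ℤ)
         (𝒞 : Clustering m n) where
  open Instance I
  open Clustering 𝒞

  Blocking : Fin m → Subset n → Kind → ℤ → Set
  Blocking i A t k =
    IsCluster t A ×
    costAvg I t i A < pow2 (k ℤ.- + 3) ×
    (∀ j → A j ≡ true → k ℤ.< ℓ j × κ i j ℤ.≤ k) ×
    (t ≡ satellite → ∃ λ c → fac c ≡ i × kind c ≡ critical × level c ℤ.≤ k) ×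
    (t ≡ critical → ∀ c → fac c ≡ i → k ℤ.≤ level c)

  record Nice : Set where
    field
      I1 : ∀ c → costAvg I (kind c) (fac c) (members c) < pow2 (level c)
      I2 : ∀ c c' → fac c ≡ fac c' → kind c ≡ critical → level c ℤ.≤ level c'
      I3 : ∀ j → κ (fac (clu j)) j ℤ.≤ ℓ j
      I4 : ∀ i A t k → ¬ Blocking i A t k

{-# OPTIONS --safe #-}

-- Fix a facility i and call a client j close to i when d i j < 2^(ℓ j - 10); only close
-- clients contribute to the sum. Every step of the argument exhibits a cluster that would be
-- blocking, which (I4) forbids. The singleton satellite {j} at the facility of a close client
-- j₀ gives ℓ j ≤ ℓ j₀ + 1 for any two close clients j₀, j, and the singleton satellite {j₀}
-- at i gives level c ≥ ℓ j₀ - 1 for every cluster c at i. Now let j₀ be a close client of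
-- minimal level. If the sum exceeded f i, the critical cluster of i and all its close clients
-- would have average cost below 2^(ℓ j₀ - 4) and so would block at level ℓ j₀ - 1.
module Submission where

open import Defs
open import Algebra.Bundles using (CommutativeMonoid)
open import Data.Bool using (true; false; if_then_else_)
open import Data.Fin using (Fin; zero; suc)
open import Data.Fin.Properties using (_≟_)
open import Data.Integer as ℤ using (ℤ; +_; -[1+_]; 1ℤ; -1ℤ)
import Data.Integer.Properties as ℤP
open import Data.Integer.Tactic.RingSolver using (solve-∀; solve)
open import Data.List using (_∷_; [])
open import Data.Nat as ℕ using (zero; suc)
import Data.Nat.Properties as ℕP
open import Data.Product using (∃; _×_; _,_; proj₂)
open import Data.Rational as ℚ using (ℚ; 0ℚ; 1ℚ; ½; _+_; _*_; _-_; _<_; _≤_; _/_; _⊔_)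
import Data.Rational.Properties as ℚP
open import Data.Rational.Unnormalised as ℚᵘ using (mkℚᵘ)
import Data.Rational.Unnormalised.Properties as ℚᵘP
open import Data.Sum using (_⊎_; inj₁; inj₂; [_,_]′)
open import Function using (case_of_)
open import Relation.Binary.PropositionalEquality
open import Relation.Nullary using (Dec; does; yes; no; ¬_)
open import Relation.Nullary.Decidable using (dec-true)

open import Algebra.Properties.CommutativeSemigroup
  (CommutativeMonoid.commutativeSemigroup ℚP.+-0-commutativeMonoid) using (interchange)
open import Algebra.Properties.Group ℚP.+-0-group using (//-rightDividesˡ)

dec-true⁻¹ : ∀ {A : Set} (a? : Dec A) → does a? ≡ true → A
dec-true⁻¹ (yes a) _  = a
dec-true⁻¹ (no _)  ()

dec-false⁻¹ : ∀ {A : Set} (a? : Dec A) → does a? ≡ false → ¬ A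
dec-false⁻¹ (yes _)  ()
dec-false⁻¹ (no ¬a) _ = ¬a

i-1<i : ∀ i → i ℤ.- 1ℤ ℤ.< i
i-1<i i = ℤP.i≤pred[j]⇒i<j (ℤP.≤-reflexive (ℤP.+-comm i -1ℤ))

suc[i+1]≡i+2 : ∀ i → 1ℤ ℤ.+ (i ℤ.+ 1ℤ) ≡ i ℤ.+ + 2
suc[i+1]≡i+2 = solve-∀

i-[m+k]≤i-m : ∀ i m k → i ℤ.- + (m ℕ.+ k) ℤ.≤ i ℤ.- + m
i-[m+k]≤i-m i m k = ℤP.+-monoʳ-≤ i (ℤP.neg-mono-≤ (ℤ.+≤+ (ℕP.m≤m+n m k)))

[1+1]*p≡p+p : ∀ p → (1ℚ + 1ℚ) * p ≡ p + p
[1+1]*p≡p+p p = trans (ℚP.*-distribʳ-+ p 1ℚ 1ℚ) (cong₂ _+_ (ℚP.*-identityˡ p) (ℚP.*-identityˡ p))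

/1-homo-+ : ∀ i j → (i ℤ.+ j) / 1 ≡ i / 1 + j / 1
/1-homo-+ i j = ℚP.toℚᵘ-injective (begin
  ℚ.toℚᵘ ((i ℤ.+ j) / 1)
    ≈⟨ ℚP.toℚᵘ-fromℚᵘ (mkℚᵘ (i ℤ.+ j) 0) ⟩
  mkℚᵘ (i ℤ.+ j) 0
    ≡⟨ cong₂ (λ u v → mkℚᵘ (u ℤ.+ v) 0) (ℤP.*-identityʳ i) (ℤP.*-identityʳ j) ⟨
  mkℚᵘ i 0 ℚᵘ.+ mkℚᵘ j 0
    ≈⟨ ℚᵘP.+-cong (ℚP.toℚᵘ-fromℚᵘ (mkℚᵘ i 0)) (ℚP.toℚᵘ-fromℚᵘ (mkℚᵘ j 0)) ⟨
  ℚ.toℚᵘ (i / 1) ℚᵘ.+ ℚ.toℚᵘ (j / 1)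
    ≈⟨ ℚP.toℚᵘ-homo-+ (i / 1) (j / 1) ⟨
  ℚ.toℚᵘ (i / 1 + j / 1)
    ∎)
  where open ℚᵘP.≃-Reasoning

[n/1]*[1/n]≡1 : ∀ k → (+ suc k / 1) * (+ 1 / suc k) ≡ 1ℚ
[n/1]*[1/n]≡1 k = ℚP.toℚᵘ-injective (begin
  ℚ.toℚᵘ ((+ suc k / 1) * (+ 1 / suc k))
    ≈⟨ ℚP.toℚᵘ-homo-* (+ suc k / 1) (+ 1 / suc k) ⟩
  ℚ.toℚᵘ (+ suc k / 1) ℚᵘ.* ℚ.toℚᵘ (+ 1 / suc k)
    ≈⟨ ℚᵘP.*-cong (ℚP.toℚᵘ-fromℚᵘ (mkℚᵘ (+ suc k) 0)) (ℚP.toℚᵘ-fromℚᵘ (mkℚᵘ (+ 1) k)) ⟩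
  mkℚᵘ (+ suc k) 0 ℚᵘ.* mkℚᵘ (+ 1) k
    ≈⟨ ℚᵘP.*-inverseʳ (mkℚᵘ (+ suc k) 0) ⟩
  ℚᵘ.1ℚᵘ
    ∎)
  where open ℚᵘP.≃-Reasoning

<-*-1/n : ∀ {x c} k → x < (+ suc k / 1) * c → x * (+ 1 / suc k) < c
<-*-1/n {x} {c} k x<nc = begin-strict
  x * (+ 1 / suc k)                       <⟨ ℚP.*-monoˡ-<-pos (+ 1 / suc k) {{ℚP.normalize-pos 1 (suc k)}} x<nc ⟩
  ((+ suc k / 1) * c) * (+ 1 / suc k)     ≡⟨ cong (_* (+ 1 / suc k)) (ℚP.*-comm (+ suc k / 1) c) ⟩
  (c * (+ suc k / 1)) * (+ 1 / suc k)     ≡⟨ ℚP.*-assoc c (+ suc k / 1) (+ 1 / suc k) ⟩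
  c * ((+ suc k / 1) * (+ 1 / suc k))     ≡⟨ cong (c *_) ([n/1]*[1/n]≡1 k) ⟩
  c * 1ℚ                                  ≡⟨ ℚP.*-identityʳ c ⟩
  c                                       ∎
  where open ℚP.≤-Reasoning

0⊔[x-y]≡x-y : ∀ {x y} → y ≤ x → 0ℚ ⊔ (x - y) ≡ x - y
0⊔[x-y]≡x-y {x} {y} y≤x = ℚP.p≤q⇒p⊔q≡q (begin
  0ℚ      ≡⟨ ℚP.+-inverseʳ y ⟨
  y - y   ≤⟨ ℚP.+-monoˡ-≤ (ℚ.- y) y≤x ⟩
  x - y   ∎)
  where open ℚP.≤-Reasoning

0⊔[x-y]≡0 : ∀ {x y} → x ≤ y → 0ℚ ⊔ (x - y) ≡ 0ℚ
0⊔[x-y]≡0 {x} {y} x≤y = ℚP.p≥q⇒p⊔q≡p (begin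
  x - y   ≤⟨ ℚP.+-monoˡ-≤ (ℚ.- y) x≤y ⟩
  y - y   ≡⟨ ℚP.+-inverseʳ y ⟩
  0ℚ      ∎)
  where open ℚP.≤-Reasoning

two^-pos : ∀ n → ℚ.Positive (two^ n)
two^-pos zero    = _
two^-pos (suc n) = ℚP.pos*pos⇒pos (1ℚ + 1ℚ) (two^ n) {{two^-pos n}}

half^-pos : ∀ n → ℚ.Positive (half^ n)
half^-pos zero    = _
half^-pos (suc n) = ℚP.pos*pos⇒pos ½ (half^ n) {{half^-pos n}}

pow2-pos : ∀ a → ℚ.Positive (pow2 a)
pow2-pos (+ n)    = two^-pos n
pow2-pos -[1+ n ] = half^-pos (suc n)

pow2-suc : ∀ a → pow2 (ℤ.suc a) ≡ (1ℚ + 1ℚ) * pow2 a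
pow2-suc (+ n)          = refl
pow2-suc -[1+ zero ]    = refl
pow2-suc -[1+ suc n ]   = sym (begin
  (1ℚ + 1ℚ) * (½ * half^ (suc n))  ≡⟨ ℚP.*-assoc (1ℚ + 1ℚ) ½ (half^ (suc n)) ⟨
  1ℚ * half^ (suc n)               ≡⟨ ℚP.*-identityˡ (half^ (suc n)) ⟩
  half^ (suc n)                    ∎)
  where open ≡-Reasoning

pow2-+ : ∀ n a → pow2 (+ n ℤ.+ a) ≡ two^ n * pow2 a
pow2-+ zero    a = trans (cong pow2 (ℤP.+-identityˡ a)) (sym (ℚP.*-identityˡ (pow2 a)))
pow2-+ (suc n) a = begin
  pow2 (+ suc n ℤ.+ a)          ≡⟨ cong pow2 (ℤP.suc-+ n a) ⟩
  pow2 (ℤ.suc (+ n ℤ.+ a))      ≡⟨ pow2-suc (+ n ℤ.+ a) ⟩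
  (1ℚ + 1ℚ) * pow2 (+ n ℤ.+ a)  ≡⟨ cong ((1ℚ + 1ℚ) *_) (pow2-+ n a) ⟩
  (1ℚ + 1ℚ) * (two^ n * pow2 a) ≡⟨ ℚP.*-assoc (1ℚ + 1ℚ) (two^ n) (pow2 a) ⟨
  two^ (suc n) * pow2 a         ∎
  where open ≡-Reasoning

pow2-double : ∀ a → pow2 (a ℤ.+ 1ℤ) ≡ pow2 a + pow2 a
pow2-double a = trans (cong pow2 (ℤP.+-comm a 1ℤ)) (trans (pow2-suc a) ([1+1]*p≡p+p (pow2 a)))

1≤two^ : ∀ n → 1ℚ ≤ two^ n
1≤two^ zero    = ℚP.≤-refl
1≤two^ (suc n) = begin
  1ℚ                      ≤⟨ 1≤two^ n ⟩
  two^ n                  ≡⟨ ℚP.+-identityʳ (two^ n) ⟨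
  two^ n + 0ℚ             ≤⟨ ℚP.+-monoʳ-≤ (two^ n) (ℚP.<⇒≤ (ℚP.positive⁻¹ (two^ n) {{two^-pos n}})) ⟩
  two^ n + two^ n         ≡⟨ [1+1]*p≡p+p (two^ n) ⟨
  two^ (suc n)            ∎
  where open ℚP.≤-Reasoning

pow2-mono-≤ : ∀ {a b} → a ℤ.≤ b → pow2 a ≤ pow2 b
pow2-mono-≤ {a} {b} a≤b = begin
  pow2 a                 ≡⟨ ℚP.*-identityˡ (pow2 a) ⟨
  1ℚ * pow2 a            ≤⟨ ℚP.*-monoʳ-≤-nonNeg (pow2 a) {{ℚP.pos⇒nonNeg (pow2 a) {{pow2-pos a}}}} (1≤two^ n) ⟩
  two^ n * pow2 a        ≡⟨ pow2-+ n a ⟨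
  pow2 (+ n ℤ.+ a)       ≡⟨ cong pow2 n+a≡b ⟩
  pow2 b                 ∎
  where
  open ℚP.≤-Reasoning
  n = ℤ.∣ b ℤ.- a ∣
  n+a≡b : + n ℤ.+ a ≡ b
  n+a≡b = trans (cong (ℤ._+ a) (ℤP.0≤i⇒+∣i∣≡i (ℤP.i≤j⇒0≤j-i a≤b))) (solve (b ∷ a ∷ []))

pow2-/1024 : ∀ a → pow2 a * (+ 1 / 1024) ≡ pow2 (a ℤ.- + 10)
pow2-/1024 a = begin
  pow2 a * (+ 1 / 1024)                   ≡⟨ cong (λ e → pow2 e * (+ 1 / 1024)) a≡10+b ⟩
  pow2 (+ 10 ℤ.+ b) * (+ 1 / 1024)        ≡⟨ cong (_* (+ 1 / 1024)) (pow2-+ 10 b) ⟩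
  (two^ 10 * pow2 b) * (+ 1 / 1024)       ≡⟨ cong (_* (+ 1 / 1024)) (ℚP.*-comm (two^ 10) (pow2 b)) ⟩
  (pow2 b * two^ 10) * (+ 1 / 1024)       ≡⟨ ℚP.*-assoc (pow2 b) (two^ 10) (+ 1 / 1024) ⟩
  pow2 b * 1ℚ                             ≡⟨ ℚP.*-identityʳ (pow2 b) ⟩
  pow2 b                                  ∎
  where
  open ≡-Reasoning
  b = a ℤ.- + 10
  a≡10+b : a ≡ + 10 ℤ.+ (a ℤ.- + 10)
  a≡10+b = solve (a ∷ [])

pow2[a-5]+pow2[a-6]+pow2[a-6]≡pow2[a-4] : ∀ a →
  (pow2 (a ℤ.- + 5) + pow2 (a ℤ.- + 6)) + pow2 (a ℤ.- + 6) ≡ pow2 (a ℤ.- + 4)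
pow2[a-5]+pow2[a-6]+pow2[a-6]≡pow2[a-4] a = begin
  (pow2 (a ℤ.- + 5) + pow2 (a ℤ.- + 6)) + pow2 (a ℤ.- + 6)
    ≡⟨ ℚP.+-assoc (pow2 (a ℤ.- + 5)) (pow2 (a ℤ.- + 6)) (pow2 (a ℤ.- + 6)) ⟩
  pow2 (a ℤ.- + 5) + (pow2 (a ℤ.- + 6) + pow2 (a ℤ.- + 6))
    ≡⟨ cong (λ p → pow2 (a ℤ.- + 5) + p) (pow2-double (a ℤ.- + 6)) ⟨
  pow2 (a ℤ.- + 5) + pow2 ((a ℤ.- + 6) ℤ.+ 1ℤ)
    ≡⟨ cong (λ e → pow2 (a ℤ.- + 5) + pow2 e) (ℤP.+-assoc a (ℤ.- + 6) 1ℤ) ⟩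
  pow2 (a ℤ.- + 5) + pow2 (a ℤ.- + 5)
    ≡⟨ pow2-double (a ℤ.- + 5) ⟨
  pow2 ((a ℤ.- + 5) ℤ.+ 1ℤ)
    ≡⟨ cong pow2 (ℤP.+-assoc a (ℤ.- + 5) 1ℤ) ⟩
  pow2 (a ℤ.- + 4) ∎
  where open ≡-Reasoning

IsKappa-≤ : ∀ {x κ} k → IsKappa x κ → x < pow2 (k ℤ.- + 3) → κ ℤ.≤ k
IsKappa-≤ {x} {κ} k (2^[κ-4]≤x , _) x<2^[k-3] = ℤP.≮⇒≥ λ k<κ → ℚP.<-irrefl refl (begin-strict
  pow2 (k ℤ.- + 3)          ≡⟨ cong pow2 k-3≡suc[k]-4 ⟩
  pow2 (ℤ.suc k ℤ.- + 4)    ≤⟨ pow2-mono-≤ (ℤP.+-monoˡ-≤ (ℤ.- + 4) (ℤP.i<j⇒suc[i]≤j k<κ)) ⟩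
  pow2 (κ ℤ.- + 4)          ≤⟨ 2^[κ-4]≤x ⟩
  x                         <⟨ x<2^[k-3] ⟩
  pow2 (k ℤ.- + 3)          ∎)
  where
  open ℚP.≤-Reasoning
  k-3≡suc[k]-4 : k ℤ.- + 3 ≡ (1ℤ ℤ.+ k) ℤ.- + 4
  k-3≡suc[k]-4 = solve (k ∷ [])

sumFin-mono-≤ : ∀ {n} {g h : Fin n → ℚ} → (∀ j → g j ≤ h j) → sumFin g ≤ sumFin h
sumFin-mono-≤ {zero}  _   = ℚP.≤-refl
sumFin-mono-≤ {suc n} g≤h = ℚP.+-mono-≤ (g≤h zero) (sumFin-mono-≤ (λ j → g≤h (suc j)))

sumFin-cong : ∀ {n} {g h : Fin n → ℚ} → (∀ j → g j ≡ h j) → sumFin g ≡ sumFin h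
sumFin-cong {zero}  _   = refl
sumFin-cong {suc n} g≗h = cong₂ _+_ (g≗h zero) (sumFin-cong (λ j → g≗h (suc j)))

sumFin-+ : ∀ {n} (g h : Fin n → ℚ) → sumFin (λ j → g j + h j) ≡ sumFin g + sumFin h
sumFin-+ {zero}  g h = refl
sumFin-+ {suc n} g h = trans
  (cong (λ s → g zero + h zero + s) (sumFin-+ (λ j → g (suc j)) (λ j → h (suc j))))
  (interchange (g zero) (h zero) (sumFin (λ j → g (suc j))) (sumFin (λ j → h (suc j))))

sumFin-zero : ∀ n → sumFin {n} (λ _ → 0ℚ) ≡ 0ℚ
sumFin-zero zero    = refl
sumFin-zero (suc n) = trans (ℚP.+-identityˡ _) (sumFin-zero n)

sumOn-const : ∀ {n} (A : Subset n) c → sumOn A (λ _ → c) ≡ (+ count A / 1) * c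
sumOn-const {zero}  A c = sym (ℚP.*-zeroˡ c)
sumOn-const {suc n} A c with A zero
... | false = trans (ℚP.+-identityˡ _) (sumOn-const (λ j → A (suc j)) c)
... | true  = begin
  c + sumOn (λ j → A (suc j)) (λ _ → c)   ≡⟨ cong (λ s → c + s) (sumOn-const (λ j → A (suc j)) c) ⟩
  c + (+ k / 1) * c                       ≡⟨ cong (_+ (+ k / 1) * c) (ℚP.*-identityˡ c) ⟨
  1ℚ * c + (+ k / 1) * c                  ≡⟨ ℚP.*-distribʳ-+ c 1ℚ (+ k / 1) ⟨
  (1ℚ + + k / 1) * c                      ≡⟨ cong (_* c) (/1-homo-+ 1ℤ (+ k)) ⟨
  (+ suc k / 1) * c                       ∎
  where
  open ≡-Reasoning
  k = count (λ j → A (suc j))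

sumOn-≤-count : ∀ {n} (A : Subset n) {g : Fin n → ℚ} {c} →
                (∀ j → A j ≡ true → g j ≤ c) → sumOn A g ≤ (+ count A / 1) * c
sumOn-≤-count A {g} {c} g≤c = ℚP.≤-trans (sumFin-mono-≤ pointwise) (ℚP.≤-reflexive (sumOn-const A c))
  where
  pointwise : ∀ j → (if A j then g j else 0ℚ) ≤ (if A j then c else 0ℚ)
  pointwise j with A j in j∈A
  ... | true  = g≤c j j∈A
  ... | false = ℚP.≤-refl

count-∅ : ∀ n → count {n} (λ _ → false) ≡ 0
count-∅ zero    = refl
count-∅ (suc n) = count-∅ n

count-nonempty : ∀ {n} (A : Subset n) {j} → A j ≡ true → ∃ λ k → count A ≡ suc k
count-nonempty A {zero}  A0 rewrite A0 = _ , refl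
count-nonempty A {suc j} Aj with A zero | count-nonempty (λ j → A (suc j)) Aj
... | true  | _ = _ , refl
... | false | k , eq = k , eq

-- does, not ⌊_⌋, so that singleton (suc j) (suc j′) reduces to singleton j j′
singleton : ∀ {n} → Fin n → Subset n
singleton j j′ = does (j′ ≟ j)

count-singleton : ∀ {n} (j : Fin n) → count (singleton j) ≡ 1
count-singleton {suc n} zero    = cong suc (count-∅ n)
count-singleton {suc n} (suc j) = count-singleton j

sumOn-singleton : ∀ {n} (j : Fin n) g → sumOn (singleton j) g ≡ g j
sumOn-singleton {suc n} zero    g = trans (cong (λ s → g zero + s) (sumFin-zero n)) (ℚP.+-identityʳ (g zero))
sumOn-singleton {suc n} (suc j) g = trans (ℚP.+-identityˡ _) (sumOn-singleton j (λ j′ → g (suc j′)))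

singleton-isCluster : ∀ {n} (j : Fin n) → IsCluster satellite (singleton j)
singleton-isCluster j = (j , dec-true (j ≟ j) refl) , λ _ → count-singleton j

empty⊎minimum : ∀ {n} (A : Subset n) (f : Fin n → ℤ) →
                (∀ j → A j ≡ false) ⊎
                ∃ λ j₀ → A j₀ ≡ true × ∀ j → A j ≡ true → f j₀ ℤ.≤ f j
empty⊎minimum {zero}  A f = inj₁ λ ()
empty⊎minimum {suc n} A f with A zero in A0 | empty⊎minimum (λ j → A (suc j)) (λ j → f (suc j))
... | false | inj₁ none = inj₁ λ { zero → A0 ; (suc j) → none j }
... | false | inj₂ (j₀ , j₀∈A , min) =
  inj₂ (suc j₀ , j₀∈A , λ { zero 0∈A → case trans (sym 0∈A) A0 of λ () ; (suc j) j∈A → min j j∈A })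
... | true  | inj₁ none =
  inj₂ (zero , A0 , λ { zero _ → ℤP.≤-refl ; (suc j) j∈A → case trans (sym j∈A) (none j) of λ () })
... | true  | inj₂ (j₀ , j₀∈A , min) with ℤP.≤-total (f zero) (f (suc j₀))
...   | inj₁ f0≤ = inj₂ (zero , A0 , λ { zero _ → ℤP.≤-refl ; (suc j) j∈A → ℤP.≤-trans f0≤ (min j j∈A) })
...   | inj₂ ≤f0 = inj₂ (suc j₀ , j₀∈A , λ { zero _ → ≤f0 ; (suc j) j∈A → min j j∈A })

module _ {m n} (I : Instance m n) where
  open Instance I
  open IsMetric isMetric

  d-triangle : ∀ i i′ j j′ → d i′ j ≤ (d i′ j′ + d i j′) + d i j
  d-triangle i i′ j j′ = begin
    d i′ j
      ≤⟨ dist-tri (inj₁ i′) (inj₂ j′) (inj₂ j) ⟩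
    d i′ j′ + dist (inj₂ j′) (inj₂ j)
      ≤⟨ ℚP.+-monoʳ-≤ (d i′ j′) (dist-tri (inj₂ j′) (inj₁ i) (inj₂ j)) ⟩
    d i′ j′ + (dist (inj₂ j′) (inj₁ i) + d i j)
      ≡⟨ cong (λ x → d i′ j′ + (x + d i j)) (dist-sym (inj₂ j′) (inj₁ i)) ⟩
    d i′ j′ + (d i j′ + d i j)
      ≡⟨ ℚP.+-assoc (d i′ j′) (d i j′) (d i j) ⟨
    (d i′ j′ + d i j′) + d i j
      ∎
    where open ℚP.≤-Reasoning

  costAvg-singleton : ∀ i j → costAvg I satellite i (singleton j) ≡ d i j
  costAvg-singleton i j = trans
    (cong₂ (λ s N → s * (+ 1 / suc (ℕ.pred N))) (sumOn-singleton j (d i)) (count-singleton j))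
    (ℚP.*-identityʳ (d i j))

  costAvg-< : ∀ t i {A : Subset n} {c} → (∃ λ j → A j ≡ true) →
              cost I t i A < (+ count A / 1) * c → costAvg I t i A < c
  costAvg-< t i {A} {c} (j , j∈A) cost< with count-nonempty A j∈A
  ... | k , |A|≡1+k = subst (_< c) (cong (λ N → cost I t i A * (+ 1 / suc (ℕ.pred N))) (sym |A|≡1+k))
                        (<-*-1/n k (subst (λ N → cost I t i A < (+ N / 1) * c) |A|≡1+k cost<))

module NiceClustering {m n} (I : Instance m n) (κ : Fin m → Fin n → ℤ)
         (isκ : ∀ i j → IsKappa (Instance.d I i j) (κ i j))
         (𝒞 : Clustering m n) (nice : Nice I κ 𝒞) where
  open Instance I
  open Clustering 𝒞
  open Nice nice

  budget : Fin n → ℚ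
  budget j = pow2 (ℓ j) * (+ 1 / 1024)

  budget-≤ : ∀ {j a} → ℓ j ℤ.- + 10 ℤ.≤ a → budget j ≤ pow2 a
  budget-≤ {j} ℓj-10≤a = ℚP.≤-trans (ℚP.≤-reflexive (pow2-/1024 (ℓ j))) (pow2-mono-≤ ℓj-10≤a)

  critical-below : ∀ c → ∃ λ c* → fac c* ≡ fac c × kind c* ≡ critical × level c* ℤ.≤ level c
  critical-below c with oneCrit (fac c) (c , refl)
  ... | c* , fc*≡fc , c*-critical , _ = c* , fc*≡fc , c*-critical , I2 c* c fc*≡fc c*-critical

  singleton-blocking : ∀ {i j k} c → fac c ≡ i → level c ℤ.≤ k →
                       k ℤ.< ℓ j → d i j < pow2 (k ℤ.- + 3) →
                       Blocking I κ 𝒞 i (singleton j) satellite k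
  singleton-blocking {i} {j} {k} c fc≡i c≤k k<ℓj dij<
    with critical-below c
  ... | c* , fc*≡fc , c*-critical , c*≤c =
      singleton-isCluster j
    , subst (_< pow2 (k ℤ.- + 3)) (sym (costAvg-singleton I i j)) dij<
    , (λ j′ j′∈ → subst (λ j″ → k ℤ.< ℓ j″ × κ i j″ ℤ.≤ k) (sym (dec-true⁻¹ (j′ ≟ j) j′∈))
                        (k<ℓj , IsKappa-≤ k (isκ i j) dij<))
    , (λ _ → c* , trans fc*≡fc fc≡i , c*-critical , ℤP.≤-trans c*≤c c≤k)
    , λ ()

  far-client-blocking : ∀ {i j₀ j} → d i j₀ < budget j₀ → d i j < budget j →
                        ℓ j₀ ℤ.+ 1ℤ ℤ.< ℓ j →
                        Blocking I κ 𝒞 (fac (clu j₀)) (singleton j) satellite (ℓ j ℤ.- 1ℤ)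
  far-client-blocking {i} {j₀} {j} j₀-close j-close gap =
    singleton-blocking (clu j₀) refl (ℤP.≤-trans (ℤP.i≤i+j L (+ 1)) (L+[2-k]≤e-k 1)) (i-1<i e) i₀j<
    where
    L = ℓ j₀
    e = ℓ j
    i₀ = fac (clu j₀)

    L+2≤e : L ℤ.+ + 2 ℤ.≤ e
    L+2≤e = subst (ℤ._≤ e) (suc[i+1]≡i+2 L) (ℤP.i<j⇒suc[i]≤j gap)

    L+[2-k]≤e-k : ∀ k → L ℤ.+ (+ 2 ℤ.- + k) ℤ.≤ e ℤ.- + k
    L+[2-k]≤e-k k = subst (ℤ._≤ e ℤ.- + k) (ℤP.+-assoc L (+ 2) (ℤ.- + k)) (ℤP.+-monoˡ-≤ (ℤ.- + k) L+2≤e)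

    i₀j₀< : d i₀ j₀ < pow2 (e ℤ.- + 5)
    i₀j₀< = ℚP.<-≤-trans (proj₂ (isκ i₀ j₀))
              (pow2-mono-≤ (ℤP.≤-trans (ℤP.+-monoˡ-≤ (ℤ.- + 3) (I3 j₀)) (L+[2-k]≤e-k 5)))

    ij₀< : d i j₀ < pow2 (e ℤ.- + 6)
    ij₀< = ℚP.<-≤-trans j₀-close (budget-≤ (ℤP.≤-trans (i-[m+k]≤i-m L 4 6) (L+[2-k]≤e-k 6)))

    ij< : d i j < pow2 (e ℤ.- + 6)
    ij< = ℚP.<-≤-trans j-close (budget-≤ (i-[m+k]≤i-m e 6 4))

    i₀j< : d i₀ j < pow2 ((e ℤ.- 1ℤ) ℤ.- + 3)
    i₀j< = begin-strict
      d i₀ j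
        ≤⟨ d-triangle I i i₀ j j₀ ⟩
      (d i₀ j₀ + d i j₀) + d i j
        <⟨ ℚP.+-mono-< (ℚP.+-mono-< i₀j₀< ij₀<) ij< ⟩
      (pow2 (e ℤ.- + 5) + pow2 (e ℤ.- + 6)) + pow2 (e ℤ.- + 6)
        ≡⟨ pow2[a-5]+pow2[a-6]+pow2[a-6]≡pow2[a-4] e ⟩
      pow2 (e ℤ.- + 4)
        ≡⟨ cong pow2 (ℤP.+-assoc e -1ℤ (ℤ.- + 3)) ⟨
      pow2 ((e ℤ.- 1ℤ) ℤ.- + 3)
        ∎
      where open ℚP.≤-Reasoning

  close-levels : ∀ {i j₀ j} → d i j₀ < budget j₀ → d i j < budget j → ℓ j ℤ.≤ ℓ j₀ ℤ.+ 1ℤ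
  close-levels {i} {j₀} {j} j₀-close j-close = ℤP.≮⇒≥ λ gap →
    I4 (fac (clu j₀)) (singleton j) satellite (ℓ j ℤ.- 1ℤ) (far-client-blocking j₀-close j-close gap)

  close-facility-levels : ∀ {i j₀} c → d i j₀ < budget j₀ → fac c ≡ i →
                          ℓ j₀ ℤ.- 1ℤ ℤ.≤ level c
  close-facility-levels {i} {j₀} c j₀-close fc≡i = ℤP.≮⇒≥ λ c<k →
    I4 i (singleton j₀) satellite (L ℤ.- 1ℤ)
       (singleton-blocking c fc≡i (ℤP.<⇒≤ c<k) (i-1<i L) (ℚP.<-≤-trans j₀-close (budget-≤ L-10≤L-1-3)))
    where
    L = ℓ j₀
    L-10≤L-1-3 : L ℤ.- + 10 ℤ.≤ (L ℤ.- 1ℤ) ℤ.- + 3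
    L-10≤L-1-3 = ℤP.≤-trans (i-[m+k]≤i-m L 4 6) (ℤP.≤-reflexive (sym (ℤP.+-assoc L -1ℤ (ℤ.- + 3))))

  close : Fin m → Subset n
  close i j = does (d i j ℚP.<? budget j)

  excess : Fin m → Fin n → ℚ
  excess i j = 0ℚ ⊔ (budget j - d i j)

  excess-outside : ∀ {i j} → close i j ≡ false → excess i j ≡ 0ℚ
  excess-outside {i} {j} j∉ = 0⊔[x-y]≡0 (ℚP.≮⇒≥ (dec-false⁻¹ (d i j ℚP.<? budget j) j∉))

  excess+distance : ∀ i → sumFin (excess i) + sumOn (close i) (d i) ≡ sumOn (close i) budget
  excess+distance i = trans (sym (sumFin-+ (excess i) _)) (sumFin-cong pointwise)
    where
    pointwise : ∀ j → excess i j + (if close i j then d i j else 0ℚ) ≡ (if close i j then budget j else 0ℚ)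
    pointwise j with close i j in j∈
    ... | true  = trans (cong (_+ d i j) (0⊔[x-y]≡x-y (ℚP.<⇒≤ (dec-true⁻¹ (d i j ℚP.<? budget j) j∈))))
                        (//-rightDividesˡ (d i j) (budget j))
    ... | false = cong (_+ 0ℚ) (excess-outside j∈)

  no-close-client : ∀ i → (∀ j → close i j ≡ false) → sumFin (excess i) ≤ f i
  no-close-client i none = begin
    sumFin (excess i)        ≡⟨ sumFin-cong (λ j → excess-outside (none j)) ⟩
    sumFin {n} (λ _ → 0ℚ)    ≡⟨ sumFin-zero n ⟩
    0ℚ                       ≤⟨ f-nonneg i ⟩
    f i                      ∎
    where open ℚP.≤-Reasoning

  critical-blocking : ∀ {i j₀} → close i j₀ ≡ true →
                      (∀ j → close i j ≡ true → ℓ j₀ ℤ.≤ ℓ j) →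
                      f i < sumFin (excess i) → Blocking I κ 𝒞 i (close i) critical (ℓ j₀ ℤ.- 1ℤ)
  critical-blocking {i} {j₀} j₀∈ minimal f<excess =
      ((j₀ , j₀∈) , λ ())
    , costAvg-< I critical i (j₀ , j₀∈) cost<
    , (λ j j∈ → ℤP.<-≤-trans (i-1<i L) (minimal j j∈)
              , IsKappa-≤ k (isκ i j) (ℚP.<-≤-trans (close⇒< j∈) (budget≤threshold j∈)))
    , (λ ())
    , (λ _ c fc≡i → close-facility-levels c (close⇒< j₀∈) fc≡i)
    where
    L = ℓ j₀
    k = L ℤ.- 1ℤ

    close⇒< : ∀ {j} → close i j ≡ true → d i j < budget j
    close⇒< {j} = dec-true⁻¹ (d i j ℚP.<? budget j)

    budget≤threshold : ∀ {j} → close i j ≡ true → budget j ≤ pow2 (k ℤ.- + 3)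
    budget≤threshold {j} j∈ = budget-≤ (begin
      ℓ j ℤ.- + 10              ≤⟨ ℤP.+-monoˡ-≤ (ℤ.- + 10) (close-levels (close⇒< j₀∈) (close⇒< j∈)) ⟩
      (L ℤ.+ 1ℤ) ℤ.- + 10       ≡⟨ ℤP.+-assoc L 1ℤ (ℤ.- + 10) ⟩
      L ℤ.- + 9                 ≤⟨ i-[m+k]≤i-m L 4 5 ⟩
      L ℤ.- + 4                 ≡⟨ ℤP.+-assoc L -1ℤ (ℤ.- + 3) ⟨
      k ℤ.- + 3                 ∎)
      where open ℤP.≤-Reasoning

    cost< : f i + sumOn (close i) (d i) < (+ count (close i) / 1) * pow2 (k ℤ.- + 3)
    cost< = begin-strict
      f i + sumOn (close i) (d i)                <⟨ ℚP.+-monoˡ-< (sumOn (close i) (d i)) f<excess ⟩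
      sumFin (excess i) + sumOn (close i) (d i)  ≡⟨ excess+distance i ⟩
      sumOn (close i) budget                     ≤⟨ sumOn-≤-count (close i) (λ j → budget≤threshold {j}) ⟩
      (+ count (close i) / 1) * pow2 (k ℤ.- + 3) ∎
      where open ℚP.≤-Reasoning

lemma6 : ∀ {m n} (I : Instance m n) (κ : Fin m → Fin n → ℤ)
         → (∀ i j → IsKappa (Instance.d I i j) (κ i j))
         → (𝒞 : Clustering m n) → Nice I κ 𝒞
         → ∀ i → sumFin (λ j → 0ℚ ⊔ (pow2 (Clustering.ℓ 𝒞 j) * (+ 1 / 1024) - Instance.d I i j))
                   ≤ Instance.f I i
lemma6 I κ isκ 𝒞 nice i = [ no-close-client i , minimal-close-client ]′ (empty⊎minimum (close i) ℓ)
  where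
  open Instance I using (f)
  open Clustering 𝒞 using (ℓ)
  open Nice nice using (I4)
  open NiceClustering I κ isκ 𝒞 nice

  minimal-close-client : (∃ λ j₀ → close i j₀ ≡ true × ∀ j → close i j ≡ true → ℓ j₀ ℤ.≤ ℓ j)
                       → sumFin (excess i) ≤ f i
  minimal-close-client (j₀ , j₀∈ , minimal) = ℚP.≮⇒≥ λ f<excess →
    I4 i (close i) critical (ℓ j₀ ℤ.- 1ℤ) (critical-blocking j₀∈ minimal f<excess)
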